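{- Let $q$ be an odd prime and $y$ an integer that is not a multiple of $q$, and let $r$ be a positive integer. If $r\equiv0\pmod{q}$ then $w_{q+1}^{(r)}(y)\equiv0\pmod{q}$, and if $r\equiv-1\pmod{q}$ then $w_{q+1}^{(r)}(y)\equiv-y\pmod{q}$.
   Context: $w_{n}^{(r)}(y)=\sum_{k=0}^{n}\left\{{n\atop k}\right\}(r)_{k}\,y^{k}$, where $\left\{{n\atop k}\right\}$ are Stirling numbers of the second kind and $(x)_{k}=x(x+1)\cdots(x+k-1)$, $(x)_0=1$. -}

module Defs where

open import Data.Nat as ℕ using (ℕ; zero; suc)
open import Data.Integer using (ℤ; +_; _+_; _*_; _^_)

stirling2 : ℕ → ℕ → ℕ
stirling2 zero    zero    = 1
stirling2 zero    (suc k) = 0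
stirling2 (suc n) zero    = 0
stirling2 (suc n) (suc k) = suc k ℕ.* stirling2 n (suc k) ℕ.+ stirling2 n k

rising : ℕ → ℕ → ℕ
rising x zero    = 1
rising x (suc k) = rising x k ℕ.* (x ℕ.+ k)

sumTo : ℕ → (ℕ → ℤ) → ℤ
sumTo zero    f = f 0
sumTo (suc n) f = sumTo n f + f (suc n)

w : ℕ → ℕ → ℤ → ℤ
w n r y = sumTo n (λ k → + (stirling2 n k ℕ.* rising r k) * y ^ k)

{-# OPTIONS --safe #-}
module Submission where

-- Only the residue of r matters: if q ∣ r + j then q divides every rising
-- factorial (r)_k with k > j, so modulo q the sum defining w_{n+1}^{(r)}(y)
-- collapses to its terms k ≤ j. Since S(n+1,0) = 0 and S(n+1,1) = 1, this
-- leaves 0 when j = 0 and r y ≡ -y when j = 1.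

open import Defs
open import Data.Nat as ℕ using (ℕ; suc; zero)
open import Data.Nat.Divisibility as ℕ using ()
open import Data.Nat.Primality using (Prime)
open import Data.Integer using (ℤ; +_; _-_; -_)
open import Data.Integer.Divisibility using (_∣_)
open import Relation.Nullary using (¬_)
open import Data.Product using (_×_; _,_)
open import Data.Sum using (inj₁; inj₂)
open import Function using (_∘_)
import Data.Integer as ℤ
import Data.Integer.Properties as ℤ
import Data.Nat.Properties as ℕ
import Data.Integer.Divisibility.Signed as Signed
open import Data.Integer.Tactic.RingSolver using (solve-∀)
open import Relation.Binary.PropositionalEquality

stirling2-suc-one : ∀ n → stirling2 (suc n) 1 ≡ 1
stirling2-suc-one zero    = refl
stirling2-suc-one (suc n) rewrite stirling2-suc-one n = refl

rising-one : ∀ r → rising r 1 ≡ r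
rising-one r = trans (ℕ.*-identityˡ (r ℕ.+ 0)) (ℕ.+-identityʳ r)

∣r+j⇒∣rising : ∀ {d r j k} → j ℕ.< k → d ℕ.∣ r ℕ.+ j → d ℕ.∣ rising r k
∣r+j⇒∣rising {r = r} {k = suc k} j<1+k d∣r+j with ℕ.m<1+n⇒m<n∨m≡n j<1+k
... | inj₁ j<k  = ℕ.∣m⇒∣m*n (r ℕ.+ k) (∣r+j⇒∣rising j<k d∣r+j)
... | inj₂ refl = ℕ.∣n⇒∣m*n (rising r k) d∣r+j

sumTo-suc : ∀ n (f : ℕ → ℤ) → sumTo (suc n) f ≡ f 0 ℤ.+ sumTo n (f ∘ suc)
sumTo-suc zero    f = refl
sumTo-suc (suc n) f = begin
  sumTo (suc n) f ℤ.+ f (suc (suc n))                   ≡⟨ cong (ℤ._+ f (suc (suc n))) (sumTo-suc n f) ⟩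
  f 0 ℤ.+ sumTo n (f ∘ suc) ℤ.+ f (suc (suc n))         ≡⟨ ℤ.+-assoc (f 0) _ _ ⟩
  f 0 ℤ.+ (sumTo n (f ∘ suc) ℤ.+ f (suc (suc n)))       ∎
  where open ≡-Reasoning

∣sumTo : ∀ {d} n (f : ℕ → ℤ) → (∀ k → d Signed.∣ f k) → d Signed.∣ sumTo n f
∣sumTo zero    f d∣f = d∣f 0
∣sumTo (suc n) f d∣f = Signed.∣m∣n⇒∣m+n (∣sumTo n f d∣f) (d∣f (suc n))

∣sumTo-minus-head : ∀ {d} n (f : ℕ → ℤ) → (∀ k → d Signed.∣ f (suc k)) →
              d Signed.∣ sumTo n f - f 0
∣sumTo-minus-head {d} zero f _   = Signed.divides ℤ.0ℤ (trans (ℤ.+-inverseʳ (f 0)) (sym (ℤ.*-zeroˡ d)))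
∣sumTo-minus-head (suc n) f d∣f = subst (_ Signed.∣_) (reorder (sumTo n f) (f (suc n)) (f 0))
  (Signed.∣m∣n⇒∣m+n (∣sumTo-minus-head n f d∣f) (d∣f n))
  where
  reorder : ∀ a b c → (a - c) ℤ.+ b ≡ (a ℤ.+ b) - c
  reorder = solve-∀

wTerm : ℕ → ℕ → ℤ → ℕ → ℤ
wTerm n r y k = + (stirling2 n k ℕ.* rising r k) ℤ.* y ℤ.^ k

wTerm-one : ∀ n r y → wTerm (suc n) r y 1 ≡ + r ℤ.* y
wTerm-one n r y = cong₂ (λ a b → + a ℤ.* b)
  (trans (cong₂ ℕ._*_ (stirling2-suc-one n) (rising-one r)) (ℕ.*-identityˡ r))
  (ℤ.^-identityʳ y)

∣rising⇒∣wTerm : ∀ {d} n r y k → d ℕ.∣ rising r k → + d Signed.∣ wTerm n r y k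
∣rising⇒∣wTerm n r y k d∣rising = Signed.∣m⇒∣m*n {m = + (stirling2 n k ℕ.* rising r k)} (y ℤ.^ k)
  (Signed.∣ᵤ⇒∣ (ℕ.∣n⇒∣m*n (stirling2 n k) d∣rising))

∣r⇒∣w : ∀ {d} n r y → d ℕ.∣ r → + d Signed.∣ w (suc n) r y
∣r⇒∣w {d} n r y d∣r = ∣sumTo (suc n) (wTerm (suc n) r y) divides-term
  where
  divides-term : ∀ k → + d Signed.∣ wTerm (suc n) r y k
  divides-term zero    = Signed.divides ℤ.0ℤ (sym (ℤ.*-zeroˡ (+ d)))
  divides-term (suc k) = ∣rising⇒∣wTerm (suc n) r y (suc k)
    (∣r+j⇒∣rising {k = suc k} (ℕ.s≤s ℕ.z≤n) (subst (d ℕ.∣_) (sym (ℕ.+-identityʳ r)) d∣r))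

∣1+r⇒∣w+y : ∀ {d} n r y → d ℕ.∣ suc r → + d Signed.∣ w (suc n) r y ℤ.+ y
∣1+r⇒∣w+y {d} n r y d∣r+1 =
  subst (+ d Signed.∣_) (sym w+y≡) (Signed.∣m∣n⇒∣m+n tail-divisible head-divisible)
  where
  t : ℕ → ℤ
  t = wTerm (suc n) r y ∘ suc

  tail-divisible : + d Signed.∣ sumTo n t - t 0
  tail-divisible = ∣sumTo-minus-head n t λ k → ∣rising⇒∣wTerm (suc n) r y (suc (suc k))
    (∣r+j⇒∣rising {k = suc (suc k)} (ℕ.s≤s (ℕ.s≤s ℕ.z≤n)) (subst (d ℕ.∣_) (ℕ.+-comm 1 r) d∣r+1))

  head-divisible : + d Signed.∣ + r ℤ.* y ℤ.+ y
  head-divisible = subst (+ d Signed.∣_) (trans (ℤ.suc-* (+ r) y) (ℤ.+-comm y (+ r ℤ.* y)))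
    (Signed.∣m⇒∣m*n {m = + suc r} y (Signed.∣ᵤ⇒∣ d∣r+1))

  regroup : ∀ a b c → a ℤ.+ c ≡ (a - b) ℤ.+ (b ℤ.+ c)
  regroup = solve-∀

  w+y≡ : w (suc n) r y ℤ.+ y ≡ (sumTo n t - t 0) ℤ.+ (+ r ℤ.* y ℤ.+ y)
  w+y≡ = begin
    w (suc n) r y ℤ.+ y                  ≡⟨ cong (ℤ._+ y) (sumTo-suc n (wTerm (suc n) r y)) ⟩
    ℤ.0ℤ ℤ.+ sumTo n t ℤ.+ y             ≡⟨ cong (ℤ._+ y) (ℤ.+-identityˡ (sumTo n t)) ⟩
    sumTo n t ℤ.+ y                      ≡⟨ regroup (sumTo n t) (t 0) y ⟩
    (sumTo n t - t 0) ℤ.+ (t 0 ℤ.+ y)    ≡⟨ cong (λ h → (sumTo n t - t 0) ℤ.+ (h ℤ.+ y)) (wTerm-one n r y) ⟩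
    (sumTo n t - t 0) ℤ.+ (+ r ℤ.* y ℤ.+ y) ∎
    where open ≡-Reasoning

theorem4p6 : (q : ℕ) → Prime q → ¬ (2 ℕ.∣ q) → (y : ℤ) → ¬ ((+ q) ∣ y) →
    (r : ℕ) → 1 ℕ.≤ r →
    ((q ℕ.∣ r → (+ q) ∣ w (suc q) r y) ×
     (q ℕ.∣ suc r → (+ q) ∣ (w (suc q) r y - (- y))))
theorem4p6 q _ _ y _ r _ =
    (λ q∣r → Signed.∣⇒∣ᵤ (∣r⇒∣w q r y q∣r))
  , (λ q∣r+1 → Signed.∣⇒∣ᵤ (subst (+ q Signed.∣_) w+y≡w-[-y] (∣1+r⇒∣w+y q r y q∣r+1)))
  where
  w+y≡w-[-y] : w (suc q) r y ℤ.+ y ≡ w (suc q) r y - (- y)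
  w+y≡w-[-y] = cong (λ z → w (suc q) r y ℤ.+ z) (sym (ℤ.neg-involutive y))
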